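{- Consider an instance $G=(V,E)$ of the MST problem under explorable uncertainty with predicted values $\hat w$. Let $E_M$ be the set of mandatory edges and $E_P$ the set of prediction mandatory edges. Then every $e\in E_M\triangle E_P$ satisfies $k^-(e)\ge 1$. Consequently, $k_h\ge|E_M\triangle E_P|$.
   Context: An instance is a connected (multi)graph $G=(V,E)$; each edge $e$ has unknown true weight $w_e\in\mathbb{R}_+$ and known uncertainty interval $I_e$, either open $(L_e,U_e)\ni w_e$ or trivial $\{w_e\}$ (then $L_e=U_e=w_e$); predictions $\hat w_e\in I_e$ are given. Querying $e$ reveals $w_e$. $Q\subseteq E$ is a feasible query set if some spanning tree is a minimum spanning tree for every weight assignment equal to $w_e$ on $Q$ and arbitrary in $I_e$ outside $Q$. An edge is mandatory if it belongs to every feasible query set, and prediction mandatory if it belongs to every feasible query set under the hypothesis that all true values equal the predicted values. For distinct $e,e'$, $k_{e'}(e)=0$ if $w_e$ and $\hat w_e$ lie in the same one of the regions $(-\infty,L_{e'}]$, $(L_{e'},U_{e'})$, $[U_{e'},\infty)$, else $1$; $k^-(e)=\sum_{e'\ne e}k_e(e')$ and $k_h=\sum_e\sum_{e'\ne e}k_{e'}(e)=\sum_e k^-(e)$.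
   Formalization: The true weights $w_e$, the interval endpoints, the predictions $\hat w_e$ and the weight assignments tested in the definition of feasibility take values in ℚ rather than ℝ. -}

module Defs where

open import Data.Nat using (ℕ; zero; suc)
import Data.Nat as N
open import Data.Fin using (Fin; zero; suc)
open import Data.Bool using (Bool; true; false; _∧_; _∨_; not; if_then_else_)
open import Data.Product using (Σ; _×_; _,_; proj₁; proj₂; ∃)
open import Data.Sum using (_⊎_)
open import Data.Rational using (ℚ; 0ℚ; _≤_; _<_; _+_)
open import Data.Rational.Properties using (_≤?_; _<?_)
open import Relation.Nullary using (¬_; does)
open import Relation.Binary.PropositionalEquality using (_≡_; _≢_)

sumℚ : (k : ℕ) → (Fin k → ℚ) → ℚ
sumℚ zero    f = 0ℚ
sumℚ (suc k) f = f zero + sumℚ k (λ i → f (suc i))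

sumℕ : (k : ℕ) → (Fin k → ℕ) → ℕ
sumℕ zero    f = 0
sumℕ (suc k) f = f zero N.+ sumℕ k (λ i → f (suc i))

record Multigraph : Set where
  field
    n    : ℕ
    m    : ℕ
    ends : Fin m → Fin n × Fin n

open Multigraph public

EdgeSet : Multigraph → Set
EdgeSet G = Fin (m G) → Bool

data Reach (G : Multigraph) (S : EdgeSet G) : Fin (n G) → Fin (n G) → Set where
  here  : ∀ {u} → Reach G S u u
  fwd   : ∀ {u v} (e : Fin (m G)) → S e ≡ true →
          proj₁ (ends G e) ≡ u → Reach G S (proj₂ (ends G e)) v → Reach G S u v
  bwd   : ∀ {u v} (e : Fin (m G)) → S e ≡ true →
          proj₂ (ends G e) ≡ u → Reach G S (proj₁ (ends G e)) v → Reach G S u v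

ConnectedBy : (G : Multigraph) → EdgeSet G → Set
ConnectedBy G S = ∀ u v → Reach G S u v

Connected : Multigraph → Set
Connected G = ConnectedBy G (λ _ → true)

without : (G : Multigraph) → EdgeSet G → Fin (m G) → EdgeSet G
without G S e f = S f ∧ not (does (Data.Fin._≟_ f e))

-- Acyclic: no edge of S lies on a cycle of S, i.e. no edge of S has its
-- endpoints connected in S minus that edge (a self-loop is a cycle).
Acyclic : (G : Multigraph) → EdgeSet G → Set
Acyclic G S = ∀ e → S e ≡ true →
  ¬ Reach G (without G S e) (proj₁ (ends G e)) (proj₂ (ends G e))

IsSpanningTree : (G : Multigraph) → EdgeSet G → Set
IsSpanningTree G T = ConnectedBy G T × Acyclic G T

weightOf : (G : Multigraph) → (Fin (m G) → ℚ) → EdgeSet G → ℚ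
weightOf G w T = sumℚ (m G) (λ e → if T e then w e else 0ℚ)

IsMST : (G : Multigraph) → (Fin (m G) → ℚ) → EdgeSet G → Set
IsMST G w T = IsSpanningTree G T ×
  (∀ T' → IsSpanningTree G T' → weightOf G w T ≤ weightOf G w T')

data Interval : Set where
  opn  : ℚ → ℚ → Interval
  triv : ℚ → Interval

Lo : Interval → ℚ
Lo (opn l u) = l
Lo (triv x)  = x

Up : Interval → ℚ
Up (opn l u) = u
Up (triv x)  = x

_∈I_ : ℚ → Interval → Set
x ∈I opn l u = (l < x) × (x < u)
x ∈I triv y  = x ≡ y

record Instance : Set where
  field
    G     : Multigraph
    conn  : Connected G
    I     : Fin (m G) → Interval
    w     : Fin (m G) → ℚ      -- true (unknown) weights
    ŵ     : Fin (m G) → ℚ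
    w∈I   : ∀ e → w e ∈I I e
    ŵ∈I   : ∀ e → ŵ e ∈I I e
    w≥0   : ∀ e → 0ℚ ≤ w e

open Instance public

-- Q is feasible w.r.t. the weight vector v (taken as the true weights):
-- some spanning tree is an MST for every assignment agreeing with v on Q
-- and lying in the intervals elsewhere.
Feasible : (J : Instance) → (Fin (m (G J)) → ℚ) → EdgeSet (G J) → Set
Feasible J v Q = Σ (EdgeSet (G J)) λ T →
  ∀ (v' : Fin (m (G J)) → ℚ) →
    (∀ e → Q e ≡ true → v' e ≡ v e) →
    (∀ e → v' e ∈I I J e) →
    IsMST (G J) v' T

MandatoryWrt : (J : Instance) → (Fin (m (G J)) → ℚ) → Fin (m (G J)) → Set
MandatoryWrt J v e = ∀ Q → Feasible J v Q → Q e ≡ true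

Mandatory : (J : Instance) → Fin (m (G J)) → Set
Mandatory J = MandatoryWrt J (w J)

PredMandatory : (J : Instance) → Fin (m (G J)) → Set
PredMandatory J = MandatoryWrt J (ŵ J)

InSymDiff : (J : Instance) → Fin (m (G J)) → Set
InSymDiff J e = (Mandatory J e × ¬ PredMandatory J e)
              ⊎ (PredMandatory J e × ¬ Mandatory J e)

sameRegion : Interval → ℚ → ℚ → Bool
sameRegion J a b =
     (does (a ≤? Lo J) ∧ does (b ≤? Lo J))
  ∨ (does (Lo J <? a) ∧ does (a <? Up J) ∧ does (Lo J <? b) ∧ does (b <? Up J))
  ∨ (does (Up J ≤? a) ∧ does (Up J ≤? b))

kOf : (J : Instance) → (e' e : Fin (m (G J))) → ℕ
kOf J e' e = if sameRegion (I J e') (w J e) (ŵ J e) then 0 else 1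

kMinus : (J : Instance) → Fin (m (G J)) → ℕ
kMinus J e = sumℕ (m (G J)) λ e' → if does (Data.Fin._≟_ e' e) then 0 else kOf J e e'

kh : (J : Instance) → ℕ
kh J = sumℕ (m (G J)) (kMinus J)

-- Since feasibility is upward closed, an edge e is mandatory for the weights c iff E ∖ {e} is
-- infeasible, i.e. iff no spanning tree is minimal for every value of e in its interval. An
-- edge with a trivial interval is therefore never mandatory. For an open interval (L, U), the
-- exchange properties of minimum spanning trees show that E ∖ {e} is infeasible exactly when
-- the endpoints of e are joined by edges f ≠ e with c f < U but not by edges f ≠ e with
-- c f ≤ L. If k⁻(e) = 0, every other edge has its true and its predicted weight in the same
-- region (-∞, L], (L, U), [U, ∞), so this path condition, and with it mandatoriness, is the
-- same for w and ŵ. Summing k⁻ over the distinct edges of E_M △ E_P gives k_h ≥ |E_M △ E_P|.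
--
-- Reachability is not decidable in this encoding, so spanning trees, minima and crossing
-- edges are only shown to exist in double-negated form. This suffices, since every goal is
-- a negation or a decidable inequality.

module Submission where

open import Defs
open import Algebra.Bundles using (CommutativeMonoid)
open import Data.Bool using (true)
open import Data.Fin using (Fin)
open import Data.List using (List; length)
open import Data.List.Relation.Unary.All using (All)
import Data.List.Relation.Unary.All as All
open import Data.List.Relation.Unary.Unique.Propositional using (Unique)
open import Data.Product using (_×_; _,_)
open import Data.Rational using (ℚ)
open import Relation.Binary.Bundles using (TotalPreorder)
open import Relation.Binary.PropositionalEquality using (_≡_)
open import Relation.Nullary using (Dec; yes; does)

does⇒ : ∀ {A : Set} (a? : Dec A) → does a? ≡ true → A
does⇒ (yes a) _ = a

module CommutativeMonoidSum {c ℓ} (M : CommutativeMonoid c ℓ) where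
  open import Data.Fin using (zero; suc)
  open import Data.Fin.Properties using (suc-injective)
  open import Data.Nat using (zero; suc)
  open import Function using (_∘_)
  open import Relation.Binary.PropositionalEquality using (_≢_)
  open CommutativeMonoid M renaming (_∙_ to _+_)
  open import Algebra.Properties.Monoid.Sum monoid public using (sum; sum-cong-≋; sum-cong-≗)
  open import Relation.Binary.Reasoning.Setoid setoid

  sum-update : ∀ {k} (a b : Fin k → Carrier) j → (∀ i → i ≢ j → a i ≈ b i) →
               sum a + b j ≈ sum b + a j
  sum-update {suc k} a b zero a≈b = begin
    (a zero + sum (a ∘ suc)) + b zero  ≈⟨ ∙-congʳ (∙-congˡ (sum-cong-≋ λ i → a≈b (suc i) λ ())) ⟩
    (a zero + sum (b ∘ suc)) + b zero  ≈⟨ comm _ _ ⟩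
    b zero + (a zero + sum (b ∘ suc))  ≈⟨ ∙-congˡ (comm _ _) ⟩
    b zero + (sum (b ∘ suc) + a zero)  ≈⟨ sym (assoc _ _ _) ⟩
    (b zero + sum (b ∘ suc)) + a zero  ∎
  sum-update {suc k} a b (suc j) a≈b = begin
    (a zero + sum (a ∘ suc)) + b (suc j)  ≈⟨ assoc _ _ _ ⟩
    a zero + (sum (a ∘ suc) + b (suc j))  ≈⟨ ∙-congˡ (sum-update (a ∘ suc) (b ∘ suc) j λ i i≢j →
                                                        a≈b (suc i) (i≢j ∘ suc-injective)) ⟩
    a zero + (sum (b ∘ suc) + a (suc j))  ≈⟨ ∙-congʳ (a≈b zero λ ()) ⟩
    b zero + (sum (b ∘ suc) + a (suc j))  ≈⟨ sym (assoc _ _ _) ⟩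
    (b zero + sum (b ∘ suc)) + a (suc j)  ∎

module FiniteMinimum {c ℓ₁ ℓ₂} (O : TotalPreorder c ℓ₁ ℓ₂) where
  open import Data.Bool using (Bool; false)
  open import Data.Fin using (zero; suc)
  open import Data.List using ([]; _∷_; [_]; map; _++_)
  open import Data.List.Membership.Propositional using (_∈_)
  open import Data.List.Membership.Propositional.Properties using (∈-map⁺; ∈-++⁺ˡ; ∈-++⁺ʳ)
  open import Data.List.Relation.Unary.Any using (here; there)
  open import Data.Nat using (zero; suc)
  open import Data.Product using (∃)
  open import Data.Sum using (_⊎_; inj₁; inj₂)
  import Data.Vec.Functional as Vector
  open import Function using (_∘_)
  open import Relation.Binary.PropositionalEquality as ≡ using (_≗_; refl)
  open import Relation.Nullary using (¬_; no; contradiction)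
  open import Relation.Nullary.Decidable using (¬¬-excluded-middle)
  open TotalPreorder O using (_≲_; total) renaming (Carrier to V; refl to ≲-refl; trans to ≲-trans)

  module _ {A : Set} (P : A → Set) (obj : A → V) where

    IsMinimumIn : List A → A → Set ℓ₂
    IsMinimumIn xs x = P x × ∀ y → y ∈ xs → P y → obj x ≲ obj y

    minimum-of-list : ∀ xs → ¬ ¬ ((∀ x → x ∈ xs → ¬ P x) ⊎ ∃ (IsMinimumIn xs))
    minimum-of-list []       k = k (inj₁ λ _ ())
    minimum-of-list (x ∷ xs) k = minimum-of-list xs λ r → ¬¬-excluded-middle λ px? → k (extend r px?)
      where
      extend : (∀ y → y ∈ xs → ¬ P y) ⊎ ∃ (IsMinimumIn xs) → Dec (P x) →
               (∀ y → y ∈ x ∷ xs → ¬ P y) ⊎ ∃ (IsMinimumIn (x ∷ xs))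
      extend (inj₁ none) (yes px) =
        inj₂ (x , px , λ { _ (here refl) _ → ≲-refl ; y (there y∈) py → contradiction py (none y y∈) })
      extend (inj₁ none) (no ¬px) = inj₁ λ { _ (here refl) → ¬px ; y (there y∈) → none y y∈ }
      extend (inj₂ (z , pz , z-min)) (no ¬px) =
        inj₂ (z , pz , λ { _ (here refl) px → contradiction px ¬px ; y (there y∈) → z-min y y∈ })
      extend (inj₂ (z , pz , z-min)) (yes px) with total (obj x) (obj z)
      ... | inj₁ x≲z =
        inj₂ (x , px , λ { _ (here refl) _ → ≲-refl ; y (there y∈) py → ≲-trans x≲z (z-min y y∈ py) })
      ... | inj₂ z≲x = inj₂ (z , pz , λ { _ (here refl) _ → z≲x ; y (there y∈) → z-min y y∈ })

  subsets : ∀ k → List (Fin k → Bool)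
  subsets zero    = [ Vector.[] ]
  subsets (suc k) = map (false Vector.∷_) (subsets k) ++ map (true Vector.∷_) (subsets k)

  ∈-subsets : ∀ {k} (S : Fin k → Bool) → ∃ λ S′ → S′ ∈ subsets k × S ≗ S′
  ∈-subsets {zero}  S = Vector.[] , here refl , λ ()
  ∈-subsets {suc k} S with ∈-subsets (S ∘ suc) | S zero in S₀
  ... | S′ , S′∈ , S≗S′ | false =
    false Vector.∷ S′ , ∈-++⁺ˡ (∈-map⁺ _ S′∈) , λ { zero → S₀ ; (suc i) → S≗S′ i }
  ... | S′ , S′∈ , S≗S′ | true  =
    true Vector.∷ S′ , ∈-++⁺ʳ _ (∈-map⁺ _ S′∈) , λ { zero → S₀ ; (suc i) → S≗S′ i }

  minimum-exists : ∀ {k} (P : (Fin k → Bool) → Set) (obj : (Fin k → Bool) → V) →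
    (∀ {S S′} → S ≗ S′ → P S → P S′) → (∀ {S S′} → S ≗ S′ → obj S ≡ obj S′) →
    ∃ P → ¬ ¬ ∃ λ S → P S × ∀ S′ → P S′ → obj S ≲ obj S′
  minimum-exists {k} P obj P-resp obj-resp (S₀ , pS₀) k′ = minimum-of-list P obj (subsets k) λ
    { (inj₁ none) → let (S , S∈ , S₀≗S) = ∈-subsets S₀ in none S S∈ (P-resp S₀≗S pS₀)
    ; (inj₂ (S , pS , S-min)) → k′ (S , pS , λ S′ pS′ →
        let (S″ , S″∈ , S′≗S″) = ∈-subsets S′
        in ≡.subst (obj S ≲_) (≡.sym (obj-resp S′≗S″)) (S-min S″ S″∈ (P-resp S′≗S″ pS′)))
    }

module RationalOrder where
  open import Data.Product using (∃)
  open import Data.Rational using (_+_; _≤_; _<_)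
  open import Data.Rational.Properties
    using (_≤?_; _<?_; ≤-total; ≤-trans; <-dense; <-irrefl; ≤-<-trans; <-≤-trans; ≮⇒≥; ≰⇒>;
           +-monoˡ-<; +-monoˡ-≤)
  open import Data.Sum using (_⊎_; inj₁; inj₂)
  open import Function using (const; _⇔_; mk⇔)
  open import Relation.Binary.PropositionalEquality using (refl)
  open import Relation.Nullary using (contradiction; _×-dec_; _⊎-dec_)

  <-dense-max : ∀ {a b c} → a < c → b < c → ∃ λ x → a < x × b < x × x < c
  <-dense-max {a} {b} a<c b<c with ≤-total a b
  ... | inj₁ a≤b = let (x , b<x , x<c) = <-dense b<c in x , ≤-<-trans a≤b b<x , b<x , x<c
  ... | inj₂ b≤a = let (x , a<x , x<c) = <-dense a<c in x , a<x , ≤-<-trans b≤a a<x , x<c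

  <-dense-min : ∀ {a b c} → a < b → a < c → ∃ λ x → a < x × x < b × x < c
  <-dense-min {a} {b} {c} a<b a<c with ≤-total b c
  ... | inj₁ b≤c = let (x , a<x , x<b) = <-dense a<b in x , a<x , x<b , <-≤-trans x<b b≤c
  ... | inj₂ c≤b = let (x , a<x , x<c) = <-dense a<c in x , a<x , <-≤-trans x<c c≤b , x<c

  +-cancelʳ-≤ : ∀ {p q} r → p + r ≤ q + r → p ≤ q
  +-cancelʳ-≤ r p+r≤q+r = ≮⇒≥ λ q<p → <-irrefl refl (<-≤-trans (+-monoˡ-< r q<p) p+r≤q+r)

  +-cancelʳ-< : ∀ {p q} r → p + r < q + r → p < q
  +-cancelʳ-< r p+r<q+r = ≰⇒> λ q≤p → <-irrefl refl (≤-<-trans (+-monoˡ-≤ r q≤p) p+r<q+r)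

  sameRegion-opn : ∀ {L U a b} → L < U → sameRegion (opn L U) a b ≡ true →
                   (a < U ⇔ b < U) × (a ≤ L ⇔ b ≤ L)
  sameRegion-opn {L} {U} {a} {b} L<U same with does⇒ regions? same
    where
    regions? : Dec ((a ≤ L × b ≤ L) ⊎ (L < a × a < U × L < b × b < U) ⊎ (U ≤ a × U ≤ b))
    regions? = ((a ≤? L) ×-dec (b ≤? L))
            ⊎-dec ((L <? a) ×-dec (a <? U) ×-dec (L <? b) ×-dec (b <? U))
            ⊎-dec ((U ≤? a) ×-dec (U ≤? b))
  ... | inj₁ (a≤L , b≤L) =
    mk⇔ (const (≤-<-trans b≤L L<U)) (const (≤-<-trans a≤L L<U)) , mk⇔ (const b≤L) (const a≤L)
  ... | inj₂ (inj₁ (L<a , a<U , L<b , b<U)) =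
    mk⇔ (const b<U) (const a<U) ,
    mk⇔ (λ a≤L → contradiction (<-≤-trans L<a a≤L) (<-irrefl refl))
        (λ b≤L → contradiction (<-≤-trans L<b b≤L) (<-irrefl refl))
  ... | inj₂ (inj₂ (U≤a , U≤b)) =
    mk⇔ (λ a<U → contradiction (<-≤-trans a<U U≤a) (<-irrefl refl))
        (λ b<U → contradiction (<-≤-trans b<U U≤b) (<-irrefl refl)) ,
    mk⇔ (λ a≤L → contradiction (<-≤-trans L<U (≤-trans U≤a a≤L)) (<-irrefl refl))
        (λ b≤L → contradiction (<-≤-trans L<U (≤-trans U≤b b≤L)) (<-irrefl refl))

module Reachability (G : Multigraph) where
  open import Data.Bool using (false; _∧_)
  open import Data.Bool.Properties using (∧-conicalˡ; ∧-zeroʳ; ∧-identityʳ; ¬-not)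
  open import Data.Empty using (⊥)
  open import Data.Fin using (_≟_)
  open import Data.List using ([]; _∷_; allFin)
  open import Data.List.Membership.Propositional using (_∈_)
  open import Data.List.Membership.Propositional.Properties using (∈-allFin)
  import Data.List.Relation.Unary.Any as Any
  open import Data.Product using (∃; proj₁; proj₂)
  open import Data.Sum using (_⊎_; inj₁; inj₂)
  open import Data.Vec.Functional using (updateAt)
  open import Data.Vec.Functional.Properties using (updateAt-updates; updateAt-minimal)
  open import Function using (const; _∘_; case_of_)
  open import Relation.Binary.PropositionalEquality using (_≢_; _≗_; refl; sym; trans; cong)
  open import Relation.Nullary using (¬_; no; contradiction)
  open import Relation.Nullary.Decidable using (dec-false; dec-true)
  open import Relation.Unary using (Decidable)

  Edge : Set
  Edge = Fin (m G)

  Vertex : Set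
  Vertex = Fin (n G)

  src tgt : Edge → Vertex
  src f = proj₁ (ends G f)
  tgt f = proj₂ (ends G f)

  infix  4 _⊆_
  infixl 6 _∖_

  _⊆_ : EdgeSet G → EdgeSet G → Set
  S ⊆ S′ = ∀ f → S f ≡ true → S′ f ≡ true

  _∖_ : EdgeSet G → Edge → EdgeSet G
  S ∖ g = without G S g

  insert : EdgeSet G → Edge → EdgeSet G
  insert S f = updateAt S f (const true)

  exchange : EdgeSet G → Edge → Edge → EdgeSet G
  exchange T g f = insert (T ∖ g) f

  select : {P : Edge → Set} → Decidable P → EdgeSet G
  select P? f = does (P? f)

  private
    variable
      S S′ T F : EdgeSet G
      f g h : Edge
      x y z : Vertex

  ≗⇒⊆ : S ≗ S′ → S ⊆ S′
  ≗⇒⊆ S≗S′ f Sf = trans (sym (S≗S′ f)) Sf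

  ⊆-trans : ∀ {S S′ S″ : EdgeSet G} → S ⊆ S′ → S′ ⊆ S″ → S ⊆ S″
  ⊆-trans S⊆S′ S′⊆S″ f = S′⊆S″ f ∘ S⊆S′ f

  ∌∋⇒≢ : S f ≡ false → S g ≡ true → f ≢ g
  ∌∋⇒≢ Sf Sg refl = contradiction (trans (sym Sf) Sg) λ ()

  ∖-≢ : ∀ S → (S ∖ g) f ≡ true → f ≢ g
  ∖-≢ {g} {f} S p with f ≟ g
  ... | yes _  = contradiction (trans (sym (∧-zeroʳ (S f))) p) λ ()
  ... | no f≢g = f≢g

  ∖-other : ∀ S → f ≢ g → (S ∖ g) f ≡ S f
  ∖-other {f} {g} S f≢g rewrite dec-false (f ≟ g) f≢g = ∧-identityʳ (S f)

  ∖-self : ∀ S → (S ∖ g) g ≡ false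
  ∖-self S = ¬-not λ p → ∖-≢ S p refl

  ∖-keeps : ∀ S → S f ≡ true → f ≢ g → (S ∖ g) f ≡ true
  ∖-keeps S Sf f≢g = trans (∖-other S f≢g) Sf

  ∖-⊆ : S ∖ g ⊆ S
  ∖-⊆ {S} f = ∧-conicalˡ (S f) _

  ∖-mono : S ⊆ S′ → S ∖ g ⊆ S′ ∖ g
  ∖-mono {S} {S′} S⊆S′ f p = ∖-keeps S′ (S⊆S′ f (∖-⊆ {S} f p)) (∖-≢ S p)

  ∖-absent : S g ≡ false → S ⊆ S ∖ g
  ∖-absent {S} Sg f Sf = ∖-keeps S Sf λ { refl → contradiction (trans (sym Sf) Sg) λ () }

  ∖-comm : S ∖ g ∖ h ⊆ S ∖ h ∖ g
  ∖-comm {S} {g} {h} f p = ∖-keeps (S ∖ h) (∖-keeps S (∖-⊆ {S} f p-g) (∖-≢ (S ∖ g) p)) (∖-≢ S p-g)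
    where
    p-g : (S ∖ g) f ≡ true
    p-g = ∖-⊆ {S ∖ g} f p

  ∖-cong : (∀ f → f ≢ g → S f ≡ S′ f) → S ∖ g ≗ S′ ∖ g
  ∖-cong {g} {S} {S′} S≡S′ f with f ≟ g
  ... | yes _  = trans (∧-zeroʳ (S f)) (sym (∧-zeroʳ (S′ f)))
  ... | no f≢g = cong (_∧ true) (S≡S′ f f≢g)

  select-∖-∈ : ∀ {P : Edge → Set} (P? : Decidable P) → (select P? ∖ g) f ≡ true → f ≢ g × P f
  select-∖-∈ {f = f} P? p = ∖-≢ (select P?) p , does⇒ (P? f) (∖-⊆ {select P?} f p)

  select-∖-∉ : ∀ {P : Edge → Set} (P? : Decidable P) → f ≢ g → (select P? ∖ g) f ≡ false → ¬ P f
  select-∖-∉ {f = f} P? f≢g p Pf =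
    contradiction (trans (sym (trans (sym (∖-other (select P?) f≢g)) p)) (dec-true (P? f) Pf)) λ ()

  insert-∈ : ∀ S → insert S f f ≡ true
  insert-∈ {f} S = updateAt-updates f S

  insert-other : ∀ S → h ≢ f → insert S f h ≡ S h
  insert-other {h} {f} S = updateAt-minimal h f S

  ⊆-insert : S ⊆ insert S f
  ⊆-insert {S} {f} h Sh with h ≟ f
  ... | yes refl = insert-∈ S
  ... | no h≢f   = trans (insert-other S h≢f) Sh

  insert-∖-⊆ : insert S f ∖ f ⊆ S
  insert-∖-⊆ {S} {f} h p = trans (sym (insert-other S (∖-≢ (insert S f) p))) (∖-⊆ {insert S f} h p)

  exchange-∌ : ∀ T → g ≢ f → exchange T g f g ≡ false
  exchange-∌ T g≢f = trans (insert-other (T ∖ _) g≢f) (∖-self T)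

  Reach-mono : S ⊆ S′ → Reach G S x y → Reach G S′ x y
  Reach-mono S⊆S′ here            = here
  Reach-mono S⊆S′ (fwd f Sf eq r) = fwd f (S⊆S′ f Sf) eq (Reach-mono S⊆S′ r)
  Reach-mono S⊆S′ (bwd f Sf eq r) = bwd f (S⊆S′ f Sf) eq (Reach-mono S⊆S′ r)

  Reach-trans : Reach G S x y → Reach G S y z → Reach G S x z
  Reach-trans here            r′ = r′
  Reach-trans (fwd f Sf eq r) r′ = fwd f Sf eq (Reach-trans r r′)
  Reach-trans (bwd f Sf eq r) r′ = bwd f Sf eq (Reach-trans r r′)

  Reach-edge : S f ≡ true → Reach G S (src f) (tgt f)
  Reach-edge {f = f} Sf = fwd f Sf refl here

  Reach-edge⁻¹ : S f ≡ true → Reach G S (tgt f) (src f)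
  Reach-edge⁻¹ {f = f} Sf = bwd f Sf refl here

  Reach-sym : Reach G S x y → Reach G S y x
  Reach-sym here               = here
  Reach-sym (fwd f Sf refl r) = Reach-trans (Reach-sym r) (Reach-edge⁻¹ Sf)
  Reach-sym (bwd f Sf refl r) = Reach-trans (Reach-sym r) (Reach-edge Sf)

  ¬Reach⇒∌ : ¬ Reach G S (src f) (tgt f) → S f ≡ false
  ¬Reach⇒∌ ¬r = ¬-not (¬r ∘ Reach-edge)

  Crosses : EdgeSet G → Vertex → Vertex → Vertex → Vertex → Set
  Crosses S a b x y = Reach G S x a × Reach G S b y

  PathVia : EdgeSet G → Edge → Vertex → Vertex → Set
  PathVia S f x y =
    Reach G (S ∖ f) x y ⊎ Crosses (S ∖ f) (src f) (tgt f) x y ⊎ Crosses (S ∖ f) (tgt f) (src f) x y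

  PathVia-prepend : (∀ {z} → Reach G (S ∖ f) y z → Reach G (S ∖ f) x z) → PathVia S f y z → PathVia S f x z
  PathVia-prepend p (inj₁ r)                = inj₁ (p r)
  PathVia-prepend p (inj₂ (inj₁ (r₁ , r₂))) = inj₂ (inj₁ (p r₁ , r₂))
  PathVia-prepend p (inj₂ (inj₂ (r₁ , r₂))) = inj₂ (inj₂ (p r₁ , r₂))

  Reach-split : ∀ f → Reach G S x y → PathVia S f x y
  Reach-split f here = inj₁ here
  Reach-split {S} f (fwd h Sh refl r) with h ≟ f | Reach-split f r
  ... | yes refl | inj₁ r′                = inj₂ (inj₁ (here , r′))
  ... | yes refl | inj₂ (inj₁ (_ , r′))   = inj₂ (inj₁ (here , r′))
  ... | yes refl | inj₂ (inj₂ (_ , r′))   = inj₁ r′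
  ... | no h≢f   | p                      = PathVia-prepend (fwd h (∖-keeps S Sh h≢f) refl) p
  Reach-split {S} f (bwd h Sh refl r) with h ≟ f | Reach-split f r
  ... | yes refl | inj₁ r′                = inj₂ (inj₂ (here , r′))
  ... | yes refl | inj₂ (inj₁ (_ , r′))   = inj₁ r′
  ... | yes refl | inj₂ (inj₂ (_ , r′))   = inj₂ (inj₂ (here , r′))
  ... | no h≢f   | p                      = PathVia-prepend (bwd h (∖-keeps S Sh h≢f) refl) p

  Reach-bypass : Reach G (S ∖ f) (src f) (tgt f) → Reach G S x y → Reach G (S ∖ f) x y
  Reach-bypass {f = f} bypass r with Reach-split f r
  ... | inj₁ r′                = r′
  ... | inj₂ (inj₁ (r₁ , r₂)) = Reach-trans r₁ (Reach-trans bypass r₂)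
  ... | inj₂ (inj₂ (r₁ , r₂)) = Reach-trans r₁ (Reach-trans (Reach-sym bypass) r₂)

  crossing-edge : Reach G S x y → ¬ Reach G S′ x y →
    ¬ ¬ ∃ λ f → S f ≡ true × ¬ Reach G S′ (src f) (tgt f)
  crossing-edge here ¬r k = ¬r here
  crossing-edge (fwd f Sf refl r) ¬r k =
    k (f , Sf , λ r-f → crossing-edge r (λ r′ → ¬r (Reach-trans r-f r′)) k)
  crossing-edge (bwd f Sf refl r) ¬r k =
    k (f , Sf , λ r-f → crossing-edge r (λ r′ → ¬r (Reach-trans (Reach-sym r-f) r′)) k)

  Acyclic-mono : S′ ⊆ S → Acyclic G S → Acyclic G S′
  Acyclic-mono S′⊆S acyclic f S′f r = acyclic f (S′⊆S f S′f) (Reach-mono (∖-mono S′⊆S) r)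

  Acyclic-insert : Acyclic G F → ¬ Reach G F (src f) (tgt f) → Acyclic G (insert F f)
  Acyclic-insert {F} {f} acyclic ¬r h h∈ r with h ≟ f
  ... | yes refl = ¬r (Reach-mono insert-∖-⊆ r)
  ... | no h≢f   = closes (Reach-split f r)
    where
    Fh : F h ≡ true
    Fh = trans (sym (insert-other F h≢f)) h∈
    ⊆F∖h : insert F f ∖ h ∖ f ⊆ F ∖ h
    ⊆F∖h = ⊆-trans ∖-comm (∖-mono insert-∖-⊆)
    inF : Reach G (insert F f ∖ h ∖ f) x y → Reach G F x y
    inF = Reach-mono (⊆-trans ⊆F∖h ∖-⊆)
    closes : PathVia (insert F f ∖ h) f (src h) (tgt h) → ⊥
    closes (inj₁ r′)                = acyclic h Fh (Reach-mono ⊆F∖h r′)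
    closes (inj₂ (inj₁ (r₁ , r₂))) =
      ¬r (Reach-trans (Reach-sym (inF r₁)) (Reach-trans (Reach-edge Fh) (Reach-sym (inF r₂))))
    closes (inj₂ (inj₂ (r₁ , r₂))) =
      ¬r (Reach-trans (inF r₂) (Reach-trans (Reach-edge⁻¹ Fh) (inF r₁)))

  Reach-∖-endpoint : ∀ g → Reach G S x (src g) → Reach G (S ∖ g) x (src g) ⊎ Reach G (S ∖ g) x (tgt g)
  Reach-∖-endpoint g r with Reach-split g r
  ... | inj₁ r′               = inj₁ r′
  ... | inj₂ (inj₁ (r′ , _)) = inj₁ r′
  ... | inj₂ (inj₂ (r′ , _)) = inj₂ r′

  ConnectedBy-exchange : ConnectedBy G T → ¬ Reach G (T ∖ g) (src f) (tgt f) →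
                         ConnectedBy G (exchange T g f)
  ConnectedBy-exchange {T} {g} {f} connected ¬r u v = Reach-trans (to-src u) (Reach-sym (to-src v))
    where
    side : ∀ z → Reach G (T ∖ g) z (src g) ⊎ Reach G (T ∖ g) z (tgt g)
    side z = Reach-∖-endpoint g (connected z (src g))
    lift : Reach G (T ∖ g) x y → Reach G (exchange T g f) x y
    lift = Reach-mono ⊆-insert
    f-edge : Reach G (exchange T g f) (src f) (tgt f)
    f-edge = Reach-edge (insert-∈ (T ∖ g))
    src-tgt : Reach G (exchange T g f) (src g) (tgt g)
    src-tgt with side (src f) | side (tgt f)
    ... | inj₁ r₁ | inj₁ r₂ = contradiction (Reach-trans r₁ (Reach-sym r₂)) ¬r
    ... | inj₁ r₁ | inj₂ r₂ = Reach-trans (lift (Reach-sym r₁)) (Reach-trans f-edge (lift r₂))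
    ... | inj₂ r₁ | inj₁ r₂ = Reach-trans (lift (Reach-sym r₂)) (Reach-trans (Reach-sym f-edge) (lift r₁))
    ... | inj₂ r₁ | inj₂ r₂ = contradiction (Reach-trans r₁ (Reach-sym r₂)) ¬r
    to-src : ∀ z → Reach G (exchange T g f) z (src g)
    to-src z with side z
    ... | inj₁ r = lift r
    ... | inj₂ r = Reach-trans (lift r) (Reach-sym src-tgt)

  exchange-spanningTree : IsSpanningTree G T → ¬ Reach G (T ∖ g) (src f) (tgt f) →
                          IsSpanningTree G (exchange T g f)
  exchange-spanningTree (connected , acyclic) ¬r =
    ConnectedBy-exchange connected ¬r , Acyclic-insert (Acyclic-mono ∖-⊆ acyclic) ¬r

  Acyclic-∖-∖ : ∀ {a} → Acyclic G F → Reach G (F ∖ a) x y → Reach G (F ∖ g) x y → Reach G (F ∖ a ∖ g) x y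
  Acyclic-∖-∖ {F = F} {x = x} {y = y} {g = g} {a = a} acyclic r-a r-g with F a in Fa
  ... | false = Reach-mono (∖-mono (∖-absent Fa)) r-g
  ... | true  = avoids-a (Reach-split a r-g)
    where
    drop-g : ∀ {u v} → Reach G (F ∖ g ∖ a) u v → Reach G (F ∖ a) u v
    drop-g = Reach-mono (⊆-trans ∖-comm ∖-⊆)
    avoids-a : PathVia (F ∖ g) a x y → Reach G (F ∖ a ∖ g) x y
    avoids-a (inj₁ r)                = Reach-mono ∖-comm r
    avoids-a (inj₂ (inj₁ (r₁ , r₂))) = contradiction
      (Reach-trans (Reach-sym (drop-g r₁)) (Reach-trans r-a (Reach-sym (drop-g r₂)))) (acyclic a Fa)
    avoids-a (inj₂ (inj₂ (r₁ , r₂))) = contradiction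
      (Reach-trans (drop-g r₂) (Reach-trans (Reach-sym r-a) (drop-g r₁))) (acyclic a Fa)

  -- Delete the edges of F outside S one at a time: by Acyclic-∖-∖, deletions that each keep
  -- x and y connected also keep them connected together.
  Acyclic-restrict : ∀ A → Acyclic G F → Reach G F x y →
    (∀ g → F g ≡ true → S g ≡ false → g ∈ A) →
    (∀ g → F g ≡ true → S g ≡ false → ¬ ¬ Reach G (F ∖ g) x y) →
    ¬ ¬ Reach G S x y
  Acyclic-restrict {F = F} {S = S} [] acyclic r covered _ k = k (Reach-mono F⊆S r)
    where
    F⊆S : F ⊆ S
    F⊆S g Fg = ¬-not λ Sg → case covered g Fg Sg of λ ()
  Acyclic-restrict {F = F} {x = x} {y = y} {S = S} (a ∷ A) acyclic r covered separable with S a in Sa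
  ... | true  = Acyclic-restrict A acyclic r covered′ separable
    where
    covered′ : ∀ g → F g ≡ true → S g ≡ false → g ∈ A
    covered′ g Fg Sg = Any.tail (λ { refl → contradiction (trans (sym Sa) Sg) λ () }) (covered g Fg Sg)
  ... | false = λ k → without-a λ r-a →
    Acyclic-restrict A (Acyclic-mono ∖-⊆ acyclic) r-a covered′ (separable′ r-a) k
    where
    without-a : ¬ ¬ Reach G (F ∖ a) x y
    without-a with F a in Fa
    ... | true  = separable a Fa Sa
    ... | false = λ k → k (Reach-mono (∖-absent Fa) r)
    covered′ : ∀ g → (F ∖ a) g ≡ true → S g ≡ false → g ∈ A
    covered′ g p Sg = Any.tail (∖-≢ F p) (covered g (∖-⊆ {F} g p) Sg)
    separable′ : Reach G (F ∖ a) x y →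
                 ∀ g → (F ∖ a) g ≡ true → S g ≡ false → ¬ ¬ Reach G (F ∖ a ∖ g) x y
    separable′ r-a g p Sg k = separable g (∖-⊆ {F} g p) Sg (k ∘ Acyclic-∖-∖ acyclic r-a)

  separating-edge : Acyclic G F → Reach G F x y → ¬ Reach G S x y →
    ¬ ¬ ∃ λ g → F g ≡ true × S g ≡ false × ¬ Reach G (F ∖ g) x y
  separating-edge acyclic r ¬r k = Acyclic-restrict (allFin _) acyclic r
    (λ g _ _ → ∈-allFin g) (λ g Fg Sg ¬r-g → k (g , Fg , Sg , ¬r-g)) ¬r

module Weights (G : Multigraph) where
  open import Data.Bool using (Bool; false; if_then_else_)
  open import Data.Fin using (zero; suc)
  open import Data.Nat using (zero; suc)
  open import Data.Product using (∃; proj₂)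
  open import Data.Rational using (0ℚ; 1ℚ; _+_; _≤_; _<_)
  open import Data.Rational.Properties
    using (_≤?_; +-0-commutativeMonoid; ≤-totalPreorder; +-identityʳ; ≤-refl; ≤-trans; <-irrefl; ≤-<-trans;
           +-monoˡ-≤; +-monoʳ-≤; +-monoʳ-<; positive⁻¹; module ≤-Reasoning)
  open import Function using (_∘_)
  open import Relation.Binary.PropositionalEquality
    using (_≢_; _≗_; refl; sym; trans; cong; cong₂; subst₂; module ≡-Reasoning)
  open import Relation.Nullary using (¬_)
  open import Relation.Nullary.Decidable using (decidable-stable)
  open import Algebra.Properties.CommutativeSemigroup
    (CommutativeMonoid.commutativeSemigroup +-0-commutativeMonoid) using (xy∙z≈xz∙y)
  open Reachability G
  open RationalOrder using (+-cancelʳ-≤; +-cancelʳ-<)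
  open CommutativeMonoidSum +-0-commutativeMonoid using (sum; sum-update; sum-cong-≗)
  open FiniteMinimum ≤-totalPreorder using (minimum-exists)

  private
    variable
      S T : EdgeSet G
      c c′ : Edge → ℚ
      e f g : Edge
      b : Bool

  sumℚ≡sum : ∀ k (a : Fin k → ℚ) → sumℚ k a ≡ sum a
  sumℚ≡sum zero    a = refl
  sumℚ≡sum (suc k) a = cong (a zero +_) (sumℚ≡sum k (a ∘ suc))

  weight : (Edge → ℚ) → EdgeSet G → ℚ
  weight = weightOf G

  contribution : (Edge → ℚ) → EdgeSet G → Edge → ℚ
  contribution c T f = if T f then c f else 0ℚ

  contribution-∈ : ∀ c T → T f ≡ true → contribution c T f ≡ c f
  contribution-∈ c T Tf rewrite Tf = refl

  contribution-∉ : ∀ c T → T f ≡ false → contribution c T f ≡ 0ℚ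
  contribution-∉ c T Tf rewrite Tf = refl

  weight≡sum : ∀ c T → weight c T ≡ sum (contribution c T)
  weight≡sum c T = sumℚ≡sum (m G) (contribution c T)

  weight-cong : S ≗ T → c ≗ c′ → weight c S ≡ weight c′ T
  weight-cong {S} {T} {c} {c′} S≗T c≗c′ = begin
    weight c S               ≡⟨ weight≡sum c S ⟩
    sum (contribution c S)   ≡⟨ sum-cong-≗ (λ f → cong₂ (λ b x → if b then x else 0ℚ) (S≗T f) (c≗c′ f)) ⟩
    sum (contribution c′ T)  ≡⟨ weight≡sum c′ T ⟨
    weight c′ T              ∎
    where open ≡-Reasoning

  weight-update : ∀ j → (∀ f → f ≢ j → S f ≡ T f) → (∀ f → f ≢ j → c f ≡ c′ f) →
    weight c S + contribution c′ T j ≡ weight c′ T + contribution c S j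
  weight-update {S} {T} {c} {c′} j S≡T c≡c′ = begin
    weight c S + contribution c′ T j               ≡⟨ cong (_+ _) (weight≡sum c S) ⟩
    sum (contribution c S) + contribution c′ T j   ≡⟨ sum-update _ _ j agree ⟩
    sum (contribution c′ T) + contribution c S j   ≡⟨ cong (_+ _) (weight≡sum c′ T) ⟨
    weight c′ T + contribution c S j               ∎
    where
    open ≡-Reasoning
    agree : ∀ f → f ≢ j → contribution c S f ≡ contribution c′ T f
    agree f f≢j = cong₂ (λ b x → if b then x else 0ℚ) (S≡T f f≢j) (c≡c′ f f≢j)

  weight-∖ : ∀ c → T g ≡ true → weight c (T ∖ g) + c g ≡ weight c T
  weight-∖ {T} {g} c Tg = begin
    weight c (T ∖ g) + c g                  ≡⟨ cong (weight c (T ∖ g) +_) (contribution-∈ c T Tg) ⟨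
    weight c (T ∖ g) + contribution c T g   ≡⟨ weight-update g (λ _ f≢g → ∖-other T f≢g) (λ _ _ → refl) ⟩
    weight c T + contribution c (T ∖ g) g   ≡⟨ cong (weight c T +_) (contribution-∉ c (T ∖ g) (∖-self T)) ⟩
    weight c T + 0ℚ                         ≡⟨ +-identityʳ _ ⟩
    weight c T                              ∎
    where open ≡-Reasoning

  weight-insert : ∀ c → S f ≡ false → weight c (insert S f) ≡ weight c S + c f
  weight-insert {S} {f} c Sf = begin
    weight c (insert S f)                       ≡⟨ +-identityʳ _ ⟨
    weight c (insert S f) + 0ℚ                  ≡⟨ cong (weight c (insert S f) +_) (contribution-∉ c S Sf) ⟨
    weight c (insert S f) + contribution c S f  ≡⟨ weight-update f (λ _ → insert-other S) (λ _ _ → refl) ⟩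
    weight c S + contribution c (insert S f) f  ≡⟨ cong (weight c S +_) (contribution-∈ c (insert S f) (insert-∈ S)) ⟩
    weight c S + c f                            ∎
    where open ≡-Reasoning

  weight-exchange : ∀ c → T g ≡ true → (T ∖ g) f ≡ false →
                    weight c (exchange T g f) + c g ≡ weight c T + c f
  weight-exchange {T} {g} {f} c Tg T∖g∌f = begin
    weight c (exchange T g f) + c g   ≡⟨ cong (_+ c g) (weight-insert c T∖g∌f) ⟩
    weight c (T ∖ g) + c f + c g      ≡⟨ xy∙z≈xz∙y (weight c (T ∖ g)) (c f) (c g) ⟩
    weight c (T ∖ g) + c g + c f      ≡⟨ cong (_+ c f) (weight-∖ c Tg) ⟩
    weight c T + c f                  ∎
    where open ≡-Reasoning

  exchange-≤ : T g ≡ true → (T ∖ g) f ≡ false → c f ≤ c g → weight c (exchange T g f) ≤ weight c T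
  exchange-≤ {T} {g} {f} {c} Tg T∖g∌f cf≤cg = +-cancelʳ-≤ (c g) (begin
    weight c (exchange T g f) + c g  ≡⟨ weight-exchange c Tg T∖g∌f ⟩
    weight c T + c f                 ≤⟨ +-monoʳ-≤ (weight c T) cf≤cg ⟩
    weight c T + c g                 ∎)
    where open ≤-Reasoning

  exchange-< : T g ≡ true → (T ∖ g) f ≡ false → c f < c g → weight c (exchange T g f) < weight c T
  exchange-< {T} {g} {f} {c} Tg T∖g∌f cf<cg = +-cancelʳ-< (c g) (begin-strict
    weight c (exchange T g f) + c g  ≡⟨ weight-exchange c Tg T∖g∌f ⟩
    weight c T + c f                 <⟨ +-monoʳ-< (weight c T) cf<cg ⟩
    weight c T + c g                 ∎)
    where open ≤-Reasoning

  lighter-exchange⇒¬IsMST : T g ≡ true → ¬ Reach G (T ∖ g) (src f) (tgt f) → c f < c g → ¬ IsMST G c T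
  lighter-exchange⇒¬IsMST Tg ¬r cf<cg (tree , minimal) = <-irrefl refl
    (≤-<-trans (minimal _ (exchange-spanningTree tree ¬r)) (exchange-< Tg (¬Reach⇒∌ ¬r) cf<cg))

  reweigh-≤ : ∀ e → (∀ f → f ≢ e → c′ f ≡ c f) → S e ≡ T e →
              weight c S ≤ weight c T → weight c′ S ≤ weight c′ T
  reweigh-≤ {c′} {c} {S} {T} e agree Se≡Te S≤T = +-cancelʳ-≤ (contribution c S e) (begin
    weight c′ S + contribution c S e   ≡⟨ weight-update e (λ _ _ → refl) agree ⟩
    weight c S + contribution c′ S e   ≤⟨ +-monoˡ-≤ _ S≤T ⟩
    weight c T + contribution c′ S e   ≡⟨ cong (λ b → weight c T + (if b then c′ e else 0ℚ)) Se≡Te ⟩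
    weight c T + contribution c′ T e   ≡⟨ weight-update e (λ _ _ → refl) agree ⟨
    weight c′ T + contribution c T e   ≡⟨ cong (λ b → weight c′ T + (if b then c e else 0ℚ)) Se≡Te ⟨
    weight c′ T + contribution c S e   ∎)
    where open ≤-Reasoning

  ConnectedBy-resp : S ≗ T → ConnectedBy G S → ConnectedBy G T
  ConnectedBy-resp S≗T connected u v = Reach-mono (≗⇒⊆ S≗T) (connected u v)

  IsSpanningTree-resp : S ≗ T → IsSpanningTree G S → IsSpanningTree G T
  IsSpanningTree-resp S≗T (connected , acyclic) =
    ConnectedBy-resp S≗T connected , Acyclic-mono (≗⇒⊆ (sym ∘ S≗T)) acyclic

  -- A connected spanning subgraph with the fewest edges is acyclic.
  spanningTree-exists : Connected G → ¬ ¬ ∃ (IsSpanningTree G)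
  spanningTree-exists connected k =
    minimum-exists (ConnectedBy G) (weight one) ConnectedBy-resp (λ S≗T → weight-cong S≗T λ _ → refl)
      (_ , connected) λ (S , S-connected , minimal) → k (S , S-connected , acyclic S S-connected minimal)
    where
    one : Edge → ℚ
    one _ = 1ℚ
    acyclic : ∀ S → ConnectedBy G S → (∀ S′ → ConnectedBy G S′ → weight one S ≤ weight one S′) → Acyclic G S
    acyclic S S-connected minimal f Sf bypass =
      <-irrefl refl (≤-<-trans (minimal (S ∖ f) (λ u v → Reach-bypass bypass (S-connected u v))) lighter)
      where
      lighter : weight one (S ∖ f) < weight one S
      lighter = begin-strict
        weight one (S ∖ f)        ≡⟨ +-identityʳ _ ⟨
        weight one (S ∖ f) + 0ℚ   <⟨ +-monoʳ-< (weight one (S ∖ f)) (positive⁻¹ 1ℚ) ⟩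
        weight one (S ∖ f) + 1ℚ   ≡⟨ weight-∖ one Sf ⟩
        weight one S              ∎
        where open ≤-Reasoning

  IsMST-cong : c ≗ c′ → IsMST G c T → IsMST G c′ T
  IsMST-cong c≗c′ (tree , minimal) = tree , λ T′ tree′ →
    subst₂ _≤_ (weight-cong (λ _ → refl) c≗c′) (weight-cong (λ _ → refl) c≗c′) (minimal T′ tree′)

  IsMST-exists : Connected G → ∀ c → ¬ ¬ ∃ (IsMST G c)
  IsMST-exists connected c k = spanningTree-exists connected λ tree →
    minimum-exists (IsSpanningTree G) (weight c) IsSpanningTree-resp
      (λ S≗T → weight-cong S≗T λ _ → refl) tree k

  SpanningTreeWith : Edge → Bool → EdgeSet G → Set
  SpanningTreeWith e b T = IsSpanningTree G T × T e ≡ b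

  minimal-SpanningTreeWith : ∀ c → ∃ (SpanningTreeWith e b) →
    ¬ ¬ ∃ λ T → SpanningTreeWith e b T × ∀ T′ → SpanningTreeWith e b T′ → weight c T ≤ weight c T′
  minimal-SpanningTreeWith {e} c = minimum-exists (SpanningTreeWith e _) (weight c)
    (λ S≗T (tree , Se) → IsSpanningTree-resp S≗T tree , trans (sym (S≗T e)) Se)
    (λ S≗T → weight-cong S≗T λ _ → refl)

  IsMST-by-improvement : ∀ (P : EdgeSet G → Set) → IsSpanningTree G T →
    (∀ T′ → P T′ → weight c T ≤ weight c T′) →
    (∀ T′ → IsSpanningTree G T′ → ¬ ¬ ∃ λ T″ → P T″ × weight c T″ ≤ weight c T′) →
    IsMST G c T
  IsMST-by-improvement P tree minimal improve = tree , λ T′ tree′ →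
    decidable-stable (_ ≤? _) λ T≰T′ →
      improve T′ tree′ λ (T″ , PT″ , T″≤T′) → T≰T′ (≤-trans (minimal T″ PT″) T″≤T′)

  improve-avoiding : S e ≡ false → Reach G S (src e) (tgt e) → (∀ f → S f ≡ true → c f ≤ c e) →
    IsSpanningTree G T → ¬ ¬ ∃ λ T′ → SpanningTreeWith e false T′ × weight c T′ ≤ weight c T
  improve-avoiding {S} {e} {T = T} Se r light tree k with T e in Te
  ... | false = k (T , (tree , Te) , ≤-refl)
  ... | true  = crossing-edge r (proj₂ tree e Te) λ (f , Sf , ¬r-f) →
    k (exchange T e f , (exchange-spanningTree tree ¬r-f , exchange-∌ T (∌∋⇒≢ Se Sf)) ,
       exchange-≤ Te (¬Reach⇒∌ ¬r-f) (light f Sf))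

  improve-containing : ¬ Reach G S (src e) (tgt e) → (∀ g → S g ≡ false → c e ≤ c g) →
    IsSpanningTree G T → ¬ ¬ ∃ λ T′ → SpanningTreeWith e true T′ × weight c T′ ≤ weight c T
  improve-containing {T = T} ¬r heavy (connected , acyclic) k =
    separating-edge acyclic (connected _ _) ¬r λ (g , Tg , Sg , ¬r-g) →
      k (exchange T g _ , (exchange-spanningTree (connected , acyclic) ¬r-g , insert-∈ (T ∖ g)) ,
         exchange-≤ Tg (¬Reach⇒∌ ¬r-g) (heavy g Sg))

module Feasibility (J : Instance) where
  open import Data.Bool.Properties using (¬-not)
  open import Data.Fin using (_≟_)
  open import Data.Product using (∃)
  open import Data.Rational using (_≤_)
  open import Function using (_∘_)
  open import Relation.Binary.PropositionalEquality using (_≢_; _≗_; refl; sym; trans; subst)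
  open import Relation.Nullary using (¬_; no)
  open Reachability (G J)
  open Weights (G J)

  Valid : (Edge → ℚ) → Set
  Valid c = ∀ f → c f ∈I I J f

  allBut : Edge → EdgeSet (G J)
  allBut e = (λ _ → true) ∖ e

  private
    variable
      c c′ : Edge → ℚ
      Q Q′ : EdgeSet (G J)
      e : Edge

  allBut-agrees : (∀ f → allBut e f ≡ true → c′ f ≡ c f) → ∀ f → f ≢ e → c′ f ≡ c f
  allBut-agrees agree f f≢e = agree f (∖-keeps (λ _ → true) refl f≢e)

  Feasible-mono : Q ⊆ Q′ → Feasible J c Q → Feasible J c Q′
  Feasible-mono Q⊆Q′ (T , T-mst) = T , λ c′ agree → T-mst c′ λ f Qf → agree f (Q⊆Q′ f Qf)

  mandatory⇒allBut-infeasible : MandatoryWrt J c e → ¬ Feasible J c (allBut e)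
  mandatory⇒allBut-infeasible {e = e} mandatory feasible =
    ∖-≢ {g = e} (λ _ → true) (mandatory (allBut e) feasible) refl

  allBut-infeasible⇒mandatory : ¬ Feasible J c (allBut e) → MandatoryWrt J c e
  allBut-infeasible⇒mandatory infeasible Q feasible = ¬-not λ Qe →
    infeasible (Feasible-mono (λ f Qf → ∖-keeps (λ _ → true) refl (∌∋⇒≢ {Q} Qe Qf ∘ sym)) feasible)

  trivial⇒allBut-feasible : ∀ {x} → I J e ≡ triv x → Valid c → ¬ ¬ Feasible J c (allBut e)
  trivial⇒allBut-feasible {e} {c} I-e valid k = IsMST-exists (conn J) c λ (T , T-mst) →
    k (T , λ c′ agree valid′ → IsMST-cong (c≗c′ c′ agree valid′) T-mst)
    where
    c≗c′ : ∀ c′ → (∀ f → allBut e f ≡ true → c′ f ≡ c f) → Valid c′ → c ≗ c′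
    c≗c′ c′ agree valid′ f with f ≟ e
    ... | yes refl = trans (subst (c f ∈I_) I-e (valid f)) (sym (subst (c′ f ∈I_) I-e (valid′ f)))
    ... | no f≢e   = sym (allBut-agrees agree f f≢e)

  -- Take T of least c-weight among the spanning trees whose e-status is b. Reweighing e shifts
  -- the weights of all these trees equally (reweigh-≤), and improve reduces every tree to one
  -- of them, so T is an MST for every admissible weight of e.
  allBut-feasible-by-improvement : ∀ b → Valid c →
    (∀ c′ → (∀ f → f ≢ e → c′ f ≡ c f) → Valid c′ → ∀ T → IsSpanningTree (G J) T →
       ¬ ¬ ∃ λ T′ → SpanningTreeWith e b T′ × weight c′ T′ ≤ weight c′ T) →
    ¬ ¬ Feasible J c (allBut e)
  allBut-feasible-by-improvement {c} {e} b valid improve k =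
    spanningTree-exists (conn J) λ (T₀ , tree₀) →
    improve c (λ _ _ → refl) valid T₀ tree₀ λ (T₁ , T₁-with , _) →
    minimal-SpanningTreeWith c (T₁ , T₁-with) λ (T , (tree , Te) , minimal) →
    k (T , λ c′ agree valid′ → IsMST-by-improvement (SpanningTreeWith e b) tree
      (λ T′ (tree′ , T′e) →
         reweigh-≤ e (allBut-agrees agree) (trans Te (sym T′e)) (minimal T′ (tree′ , T′e)))
      (improve c′ (allBut-agrees agree) valid′))

module OpenEdge (J : Instance) (e : Fin (m (G J))) {L U : ℚ} (I-e : I J e ≡ opn L U) where
  open import Data.Bool using (false)
  open import Data.Fin using (_≟_)
  open import Data.Product using (∃; proj₁; proj₂)
  open import Data.Rational using (_≤_; _<_)
  open import Data.Rational.Properties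
    using (_≤?_; _<?_; <-dense; <-≤-trans; <-trans; ≤-trans; ≤-refl; ≤-reflexive; <⇒≤; ≰⇒>; ≮⇒≥)
  open import Data.Vec.Functional using (updateAt)
  open import Data.Vec.Functional.Properties using (updateAt-updates; updateAt-minimal)
  open import Function using (_∘_; const; _⇔_; case_of_)
  open import Relation.Binary.PropositionalEquality using (_≢_; _≗_; refl; sym; subst; subst₂)
  open import Relation.Nullary using (¬_; no; contradiction)
  open import Relation.Nullary.Decidable using (¬¬-excluded-middle; does-⇔)
  open import Relation.Nullary.Negation using (¬¬-map)
  open Reachability (G J)
  open Weights (G J)
  open Feasibility J
  open RationalOrder using (<-dense-max; <-dense-min; sameRegion-opn)

  private
    variable
      c c′ : Edge → ℚ
      x : ℚ
      T : EdgeSet (G J)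

  belowUpper : (Edge → ℚ) → EdgeSet (G J)
  belowUpper c = select (λ f → c f <? U) ∖ e

  atMostLower : (Edge → ℚ) → EdgeSet (G J)
  atMostLower c = select (λ f → c f ≤? L) ∖ e

  inside : x ∈I I J e → L < x × x < U
  inside {x} = subst (x ∈I_) I-e

  L<U : Valid c → L < U
  L<U {c} valid = let (L<ce , ce<U) = inside (valid e) in <-trans L<ce ce<U

  reweigh : (Edge → ℚ) → ℚ → Edge → ℚ
  reweigh c x = updateAt c e (const x)

  reweigh-agrees : ∀ f → allBut e f ≡ true → reweigh c x f ≡ c f
  reweigh-agrees {c} f p = updateAt-minimal f e c (∖-≢ (λ _ → true) p)

  reweigh-valid : Valid c → L < x → x < U → Valid (reweigh c x)
  reweigh-valid {c} {x} valid L<x x<U f with f ≟ e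
  ... | yes refl = subst (_∈I I J e) (sym (updateAt-updates e c)) (subst (x ∈I_) (sym I-e) (L<x , x<U))
  ... | no f≢e   = subst (_∈I I J f) (sym (updateAt-minimal f e c f≢e)) (valid f)

  UniformMST : (Edge → ℚ) → EdgeSet (G J) → Set
  UniformMST c T = ∀ x → L < x → x < U → IsMST (G J) (reweigh c x) T

  allBut-feasible⇒UniformMST : Valid c → Feasible J c (allBut e) → ∃ (UniformMST c)
  allBut-feasible⇒UniformMST {c} valid (T , T-mst) =
    T , λ x L<x x<U → T-mst (reweigh c x) reweigh-agrees (reweigh-valid valid L<x x<U)

  UniformMST⇒tree : Valid c → UniformMST c T → IsSpanningTree (G J) T
  UniformMST⇒tree valid mst = let (x , L<x , x<U) = <-dense (L<U valid) in proj₁ (mst x L<x x<U)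

  -- A path of edges below U contains an edge f that reconnects T ∖ e; raising e above c f then
  -- makes T - e + f lighter than T.
  UniformMST-∋⇒¬belowUpper : Valid c → UniformMST c T → T e ≡ true →
    ¬ Reach (G J) (belowUpper c) (src e) (tgt e)
  UniformMST-∋⇒¬belowUpper {c} valid mst Te below =
    crossing-edge below (proj₂ (UniformMST⇒tree valid mst) e Te) λ (f , f∈ , ¬r-f) →
      let (f≢e , cf<U) = select-∖-∈ (λ f → c f <? U) f∈
          (x , L<x , cf<x , x<U) = <-dense-max (L<U valid) cf<U
      in lighter-exchange⇒¬IsMST Te ¬r-f
           (subst₂ _<_ (sym (updateAt-minimal f e c f≢e)) (sym (updateAt-updates e c)) cf<x)
           (mst x L<x x<U)

  -- Otherwise the path of T between the endpoints of e has an edge g with L < c g; lowering e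
  -- below c g then makes T - g + e lighter than T.
  UniformMST-∌⇒atMostLower : Valid c → UniformMST c T → T e ≡ false →
    ¬ ¬ Reach (G J) (atMostLower c) (src e) (tgt e)
  UniformMST-∌⇒atMostLower {c} {T} valid mst Te ¬atMost =
    let (connected , acyclic) = UniformMST⇒tree valid mst
    in separating-edge acyclic (connected (src e) (tgt e)) ¬atMost λ (g , Tg , g∉ , ¬r-g) →
      let g≢e = ∌∋⇒≢ {T} Te Tg ∘ sym
          L<cg = ≰⇒> (select-∖-∉ (λ f → c f ≤? L) g≢e g∉)
          (x , L<x , x<cg , x<U) = <-dense-min L<cg (L<U valid)
      in lighter-exchange⇒¬IsMST Tg ¬r-g
           (subst₂ _<_ (sym (updateAt-updates e c)) (sym (updateAt-minimal g e c g≢e)) x<cg)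
           (mst x L<x x<U)

  allBut-feasible⇒ : Valid c → Feasible J c (allBut e) →
    Reach (G J) (belowUpper c) (src e) (tgt e) → ¬ ¬ Reach (G J) (atMostLower c) (src e) (tgt e)
  allBut-feasible⇒ valid feasible below with allBut-feasible⇒UniformMST valid feasible
  ... | T , mst with T e in Te
  ...   | true  = contradiction below (UniformMST-∋⇒¬belowUpper valid mst Te)
  ...   | false = UniformMST-∌⇒atMostLower valid mst Te

  atMostLower⇒allBut-feasible : Valid c → Reach (G J) (atMostLower c) (src e) (tgt e) →
    ¬ ¬ Feasible J c (allBut e)
  atMostLower⇒allBut-feasible {c} valid atMost =
    allBut-feasible-by-improvement false valid λ c′ agree valid′ _ tree →
      improve-avoiding (∖-self (select (λ f → c f ≤? L))) atMost (light c′ agree valid′) tree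
    where
    light : ∀ c′ → (∀ f → f ≢ e → c′ f ≡ c f) → Valid c′ → ∀ f → atMostLower c f ≡ true → c′ f ≤ c′ e
    light c′ agree valid′ f f∈ =
      let (f≢e , cf≤L) = select-∖-∈ (λ f → c f ≤? L) f∈
      in ≤-trans (≤-reflexive (agree f f≢e)) (≤-trans cf≤L (<⇒≤ (proj₁ (inside (valid′ e)))))

  ¬belowUpper⇒allBut-feasible : Valid c → ¬ Reach (G J) (belowUpper c) (src e) (tgt e) →
    ¬ ¬ Feasible J c (allBut e)
  ¬belowUpper⇒allBut-feasible {c} valid ¬below =
    allBut-feasible-by-improvement true valid λ c′ agree valid′ _ tree →
      improve-containing ¬below (heavy c′ agree valid′) tree
    where
    heavy : ∀ c′ → (∀ f → f ≢ e → c′ f ≡ c f) → Valid c′ → ∀ g → belowUpper c g ≡ false → c′ e ≤ c′ g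
    heavy c′ agree valid′ g g∉ = case g ≟ e of λ
      { (yes refl) → ≤-refl
      ; (no g≢e)   → <⇒≤ (<-≤-trans (proj₂ (inside (valid′ e))) (≤-trans
                       (≮⇒≥ (select-∖-∉ (λ f → c f <? U) g≢e g∉)) (≤-reflexive (sym (agree g g≢e)))))
      }

  allBut-feasible⇐ : Valid c →
    (Reach (G J) (belowUpper c) (src e) (tgt e) → ¬ ¬ Reach (G J) (atMostLower c) (src e) (tgt e)) →
    ¬ ¬ Feasible J c (allBut e)
  allBut-feasible⇐ valid below⇒atMost infeasible = ¬¬-excluded-middle λ
    { (yes atMost) → atMostLower⇒allBut-feasible valid atMost infeasible
    ; (no ¬atMost) → ¬belowUpper⇒allBut-feasible valid (λ below → below⇒atMost below ¬atMost) infeasible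
    }

  mandatory-transfer : Valid c → Valid c′ → belowUpper c ⊆ belowUpper c′ → atMostLower c′ ⊆ atMostLower c →
    MandatoryWrt J c e → MandatoryWrt J c′ e
  mandatory-transfer valid valid′ below⊆ atMost⊆ mandatory = allBut-infeasible⇒mandatory λ feasible′ →
    allBut-feasible⇐ valid
      (λ below → ¬¬-map (Reach-mono atMost⊆) (allBut-feasible⇒ valid′ feasible′ (Reach-mono below⊆ below)))
      (mandatory⇒allBut-infeasible mandatory)

  sameRegion⇒≗ : Valid c → (∀ f → f ≢ e → sameRegion (opn L U) (c f) (c′ f) ≡ true) →
    belowUpper c ≗ belowUpper c′ × atMostLower c ≗ atMostLower c′
  sameRegion⇒≗ {c} {c′} valid same =
    ∖-cong (λ f f≢e → does-⇔ (proj₁ (regions f f≢e)) (c f <? U) (c′ f <? U)) ,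
    ∖-cong (λ f f≢e → does-⇔ (proj₂ (regions f f≢e)) (c f ≤? L) (c′ f ≤? L))
    where
    regions : ∀ f → f ≢ e → (c f < U ⇔ c′ f < U) × (c f ≤ L ⇔ c′ f ≤ L)
    regions f f≢e = sameRegion-opn (L<U valid) (same f f≢e)

open import Data.Nat using (_≤_)

module Counting where
  open import Data.Nat using (ℕ; zero; suc; _+_; z≤n)
  open import Data.Nat.Properties
    using (+-0-commutativeMonoid; +-identityʳ; +-comm; m≤m+n; +-mono-≤; module ≤-Reasoning)
  open import Data.Fin using (zero; suc)
  open import Data.List using ([]; _∷_)
  open import Data.List.Relation.Unary.All using (_∷_)
  import Data.List.Relation.Unary.All as All
  open import Data.List.Relation.Unary.AllPairs using (_∷_)
  open import Data.Product using (_,_)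
  open import Data.Vec.Functional using (updateAt)
  open import Data.Vec.Functional.Properties using (updateAt-updates; updateAt-minimal)
  open import Function using (_∘_; const)
  open import Relation.Binary.PropositionalEquality using (_≡_; refl; sym; cong; subst; module ≡-Reasoning)
  open CommutativeMonoidSum +-0-commutativeMonoid using (sum; sum-update)

  sumℕ≡sum : ∀ k (f : Fin k → ℕ) → sumℕ k f ≡ sum f
  sumℕ≡sum zero    f = refl
  sumℕ≡sum (suc k) f = cong (f zero +_) (sumℕ≡sum k (f ∘ suc))

  sumℕ-pick : ∀ k (f : Fin k → ℕ) d → sumℕ k f ≡ f d + sumℕ k (updateAt f d (const 0))
  sumℕ-pick k f d = begin
    sumℕ k f              ≡⟨ sumℕ≡sum k f ⟩
    sum f                 ≡⟨ +-identityʳ _ ⟨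
    sum f + 0             ≡⟨ cong (sum f +_) (updateAt-updates d f) ⟨
    sum f + f′ d          ≡⟨ sum-update f f′ d (λ i i≢d → sym (updateAt-minimal i d f i≢d)) ⟩
    sum f′ + f d          ≡⟨ +-comm (sum f′) (f d) ⟩
    f d + sum f′          ≡⟨ cong (f d +_) (sumℕ≡sum k f′) ⟨
    f d + sumℕ k f′       ∎
    where
    open ≡-Reasoning
    f′ : Fin k → ℕ
    f′ = updateAt f d (const 0)

  ≤-sumℕ : ∀ k (f : Fin k → ℕ) d → f d ≤ sumℕ k f
  ≤-sumℕ k f d = subst (f d ≤_) (sym (sumℕ-pick k f d)) (m≤m+n (f d) _)

  length≤sumℕ : ∀ {k} (f : Fin k → ℕ) (D : List (Fin k)) → Unique D → All (λ d → 1 ≤ f d) D →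
                length D ≤ sumℕ k f
  length≤sumℕ f []      _                _             = z≤n
  length≤sumℕ {k} f (d ∷ D) (d∉D ∷ unique) (1≤fd ∷ 1≤f) = begin
    1 + length D                            ≤⟨ +-mono-≤ 1≤fd (length≤sumℕ f′ D unique 1≤f′) ⟩
    f d + sumℕ k f′                         ≡⟨ sumℕ-pick k f d ⟨
    sumℕ k f                                ∎
    where
    open ≤-Reasoning
    f′ : Fin k → ℕ
    f′ = updateAt f d (const 0)
    1≤f′ : All (λ d′ → 1 ≤ f′ d′) D
    1≤f′ = All.zipWith
      (λ { {d′} (d≢d′ , 1≤fd′) → subst (1 ≤_) (sym (updateAt-minimal d′ d f (d≢d′ ∘ sym))) 1≤fd′ })
      (d∉D , 1≤f)

module HopDistance (J : Instance) where
  open import Data.Bool using (true; false; if_then_else_)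
  open import Data.Bool.Properties using (¬-not)
  open import Data.Fin using (_≟_)
  open import Data.Nat using (_≤?_)
  open import Data.Product using (_,_; proj₁; proj₂)
  open import Data.Sum using (inj₁; inj₂)
  open import Function using (_∘_)
  open import Relation.Nullary using (¬_; does)
  open import Relation.Nullary.Decidable using (dec-false; decidable-stable)
  open import Relation.Binary.PropositionalEquality using (_≡_; _≢_; _≗_; refl; sym; subst)
  open Reachability (G J) using (Edge; ≗⇒⊆)
  open Feasibility J
  open Counting using (≤-sumℕ)

  one≤kMinus : ∀ {e f : Edge} → f ≢ e → sameRegion (I J e) (w J f) (ŵ J f) ≡ false → 1 ≤ kMinus J e
  one≤kMinus {e} {f} f≢e differ = subst (_≤ kMinus J e) term≡1 (≤-sumℕ _ _ f)
    where
    term≡1 : (if does (f ≟ e) then 0 else kOf J e f) ≡ 1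
    term≡1 rewrite dec-false (f ≟ e) f≢e | differ = refl

  sameRegions⇒¬InSymDiff : ∀ e → (∀ f → f ≢ e → sameRegion (I J e) (w J f) (ŵ J f) ≡ true) → ¬ InSymDiff J e
  sameRegions⇒¬InSymDiff e same with I J e in I-e
  ... | triv _ = λ
    { (inj₁ (mandatory , _)) →
        trivial⇒allBut-feasible I-e (w∈I J) (mandatory⇒allBut-infeasible mandatory)
    ; (inj₂ (predMandatory , _)) →
        trivial⇒allBut-feasible I-e (ŵ∈I J) (mandatory⇒allBut-infeasible predMandatory)
    }
  ... | opn L U = λ
    { (inj₁ (mandatory , ¬predMandatory)) →
        ¬predMandatory (mandatory-transfer (w∈I J) (ŵ∈I J) (≗⇒⊆ below≗) (≗⇒⊆ (sym ∘ atMost≗)) mandatory)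
    ; (inj₂ (predMandatory , ¬mandatory)) →
        ¬mandatory (mandatory-transfer (ŵ∈I J) (w∈I J) (≗⇒⊆ (sym ∘ below≗)) (≗⇒⊆ atMost≗) predMandatory)
    }
    where
    open OpenEdge J e I-e
    below≗ : belowUpper (w J) ≗ belowUpper (ŵ J)
    below≗ = proj₁ (sameRegion⇒≗ {c′ = ŵ J} (w∈I J) same)
    atMost≗ : atMostLower (w J) ≗ atMostLower (ŵ J)
    atMost≗ = proj₂ (sameRegion⇒≗ {c′ = ŵ J} (w∈I J) same)

  InSymDiff⇒1≤kMinus : ∀ e → InSymDiff J e → 1 ≤ kMinus J e
  InSymDiff⇒1≤kMinus e symdiff = decidable-stable (1 ≤? kMinus J e) λ 1≰kMinus →
    sameRegions⇒¬InSymDiff e (λ f f≢e → ¬-not (1≰kMinus ∘ one≤kMinus f≢e)) symdiff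

lemma3p3 : (J : Instance) →
    (∀ e → InSymDiff J e → 1 ≤ kMinus J e) ×
    (∀ (D : List (Fin (m (G J)))) → Unique D → All (InSymDiff J) D → length D ≤ kh J)
lemma3p3 J = InSymDiff⇒1≤kMinus , λ D unique symdiffs →
  Counting.length≤sumℕ (kMinus J) D unique (All.map (InSymDiff⇒1≤kMinus _) symdiffs)
  where
  open HopDistance J
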